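{- Let $G$ be a finite directed acyclic multigraph (identified with its set of arcs) having exactly one source $s$ (vertex with no incoming arcs) and exactly one sink $t$ (vertex with no outgoing arcs). Then the unique real multilinear polynomial representing $\textsc{DAG-Connectivity}_G$ is \[p_G(x)=\sum_{H\in U(P_G)\setminus\{\emptyset\}}(-1)^{D(H)}\prod_{e\in H}x_e.\]
   Context: $\textsc{DAG-Connectivity}_G:\{0,1\}^{G}\to\{0,1\}$ takes one bit $x_e$ per arc $e$ of $G$ (with $x_e=1$ meaning the arc is present) and outputs $1$ iff the present arcs contain a non-empty directed path from $s$ to $t$. $P_G$ is the set of directed paths from $s$ to $t$ in $G$, each regarded as a set of arcs; $U(P_G)=\{\bigcup_{p\in B}p\mid B\subseteq P_G\}$ is the set of all unions of such paths (including $\emptyset$). For an arc $e$ let $s(e),t(e)$ be its tail and head. For a set of arcs $H$, $D(H)=|H|-\bigl|\bigl(\{s(e)\mid e\in H\}\cup\{t(e)\mid e\in H\}\bigr)\setminus\{s,t\}\bigr|-1$. A real multilinear polynomial $p$ represents a Boolean function $f$ if $p(x)=f(x)$ for all $x\in\{0,1\}^{G}$.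
   Formalization: The multilinear polynomials, including every representing polynomial in the uniqueness claim, have rational coefficients rather than real ones. -}

module Defs where

open import Data.Bool using (Bool; true; false; if_then_else_; _∨_; _∧_)
open import Data.Nat using (ℕ; zero; suc)
open import Data.Integer using (ℤ; +_; _-_; ∣_∣)
open import Data.Fin using (Fin; _≟_)
open import Data.Fin.Subset using (Subset; ⊥; _∪_; ⁅_⁆) renaming (∣_∣ to card)
open import Data.Vec using (Vec; []; _∷_; lookup; tabulate)
open import Data.List using (List; []; _∷_; _++_; map; foldr; allFin)
open import Data.Bool.ListAction using (any)
open import Data.Rational using (ℚ; 0ℚ; 1ℚ; _+_; _*_; -_)
open import Data.Product using (Σ; _×_; _,_; proj₁)
open import Data.Sum using (_⊎_)
open import Data.Empty using () renaming (⊥ to Empty)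
open import Data.Unit using (⊤)
open import Relation.Nullary using (¬_; does)
open import Relation.Binary.PropositionalEquality using (_≡_; _≢_)

record Multigraph (n m : ℕ) : Set where
  field
    tail : Fin m → Fin n
    head : Fin m → Fin n
open Multigraph public

module _ {n m : ℕ} (G : Multigraph n m) where

  data Walk : Fin n → Fin n → Set where
    nil  : ∀ {v} → Walk v v
    cons : ∀ {u w} (e : Fin m) → tail G e ≡ u → Walk (head G e) w → Walk u w

  NonEmpty : ∀ {u w} → Walk u w → Set
  NonEmpty nil = Empty
  NonEmpty (cons _ _ _) = ⊤

  Acyclic : Set
  Acyclic = ∀ v (c : Walk v v) → ¬ NonEmpty c

  IsSource IsSink : Fin n → Set
  IsSource v = ∀ e → head G e ≢ v
  IsSink   v = ∀ e → tail G e ≢ v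

  UniqueSource UniqueSink : Fin n → Set
  UniqueSource s = IsSource s × (∀ v → IsSource v → v ≡ s)
  UniqueSink   t = IsSink t   × (∀ v → IsSink v → v ≡ t)

  arcSet : ∀ {u w} → Walk u w → Subset m
  arcSet nil = ⊥
  arcSet (cons e _ p) = ⁅ e ⁆ ∪ arcSet p

  _∈ₐ_ : Fin m → Subset m → Set
  e ∈ₐ H = lookup H e ≡ true

  -- P_G : non-empty directed paths from s to t (in a DAG every walk is a path)
  Path : Fin n → Fin n → Set
  Path s t = Σ (Walk s t) NonEmpty

  -- H ∈ U(P_G): H is the union of some (finite) collection B of paths
  InU : Fin n → Fin n → Subset m → Set
  InU s t H = Σ (List (Path s t)) λ B → foldr (λ p acc → arcSet (proj₁ p) ∪ acc) ⊥ B ≡ H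

  innerVertices : Fin n → Fin n → Subset m → Subset n
  innerVertices s t H = tabulate λ v →
    (if does (v ≟ s) ∨ does (v ≟ t) then false else
      any (λ e → lookup H e ∧ (does (tail G e ≟ v) ∨ does (head G e ≟ v))) (allFin m))

  D : Fin n → Fin n → Subset m → ℤ
  D s t H = (+ card H - + card (innerVertices s t H)) - + 1

  Connected : Fin n → Fin n → (Fin m → Bool) → Set
  Connected s t x = Σ (Path s t) λ p → ∀ e → e ∈ₐ arcSet (proj₁ p) → x e ≡ true

neg1^ : ℕ → ℚ
neg1^ zero = 1ℚ
neg1^ (suc k) = - neg1^ k

sign : ℤ → ℚ
sign d = neg1^ ∣ d ∣

allSubsets : ∀ m → List (Subset m)
allSubsets zero = [] ∷ []
allSubsets (suc m) = map (false ∷_) (allSubsets m) ++ map (true ∷_) (allSubsets m)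

sumℚ : List ℚ → ℚ
sumℚ = foldr _+_ 0ℚ

bitℚ : Bool → ℚ
bitℚ true = 1ℚ
bitℚ false = 0ℚ

monomial : ∀ {m} → Subset m → (Fin m → ℚ) → ℚ
monomial {m} S x = foldr (λ e acc → (if lookup S e then x e else 1ℚ) * acc) 1ℚ (allFin m)

-- a multilinear polynomial over ℚ in variables Fin m is given by its
-- coefficient function on monomials (subsets of variables)
MultilinearPoly : ℕ → Set
MultilinearPoly m = Subset m → ℚ

eval : ∀ {m} → MultilinearPoly m → (Fin m → ℚ) → ℚ
eval {m} c x = sumℚ (map (λ S → c S * monomial S x) (allSubsets m))

Represents : ∀ {n m} (G : Multigraph n m) (s t : Fin n) → MultilinearPoly m → Set
Represents {m = m} G s t c = ∀ (x : Fin m → Bool) →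
  (Connected G s t x → eval c (λ e → bitℚ (x e)) ≡ 1ℚ) ×
  (¬ Connected G s t x → eval c (λ e → bitℚ (x e)) ≡ 0ℚ)

IsPG : ∀ {n m} (G : Multigraph n m) (s t : Fin n) → MultilinearPoly m → Set
IsPG G s t c = ∀ H →
  (InU G s t H → H ≢ ⊥ → c H ≡ sign (D G s t H)) ×
  ((¬ InU G s t H ⊎ H ≡ ⊥) → c H ≡ 0ℚ)

{-# OPTIONS --safe #-}
-- A multilinear polynomial over the Boolean cube is determined by its values there, and its
-- coefficient at H is the Möbius transform Σ_{S ⊆ H} (-1)^{|H∖S|} f(S) of the function it
-- represents. For f = DAG-Connectivity:
-- * if some arc e of H lies on no s–t path inside H, then toggling e never changes the
--   connectivity of a subset of H, so the alternating sum vanishes;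
-- * if H is a non-empty union of s–t paths, write f = 1 - [S disconnected]. The constant 1
--   contributes nothing, and toggling the first arc of H whose tail is unreachable from s is a
--   sign-reversing involution on the disconnected subsets. What survives are the S ⊆ H with no
--   arc into t and an arc into every inner vertex of H; peeling off the arcs one by one shows
--   that these contribute (-1)^{|H|+|V(H)∖{s,t}|}, so the coefficient is (-1)^{D(H)}.
module Submission where

open import Defs
open import Data.Bool using (Bool; true; false; T; not; if_then_else_; _∧_; _∨_)
open import Data.Bool.Properties using (T-≡; T-∧; T-∨)
open import Data.Bool.ListAction using (any)
open import Data.Nat using (ℕ; zero; suc; _≤_; _<_; s≤s)
import Data.Nat as ℕ
open import Data.Nat.Properties using (≰⇒>; <⇒≤; <⇒≱; +-suc; m≤m+n)
open import Data.Integer using (_⊖_; ∣_∣)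
import Data.Integer as ℤ
import Data.Integer.Properties as ℤ
open import Data.Integer.Properties using ([1+m]⊖[1+n]≡m⊖n; [+m]-[+n]≡m⊖n)
open import Data.Fin using (Fin; zero; suc; _≟_) renaming (_<_ to _<ᶠ_)
open import Data.Fin.Properties using (any?; all?; ¬∀⟶∃¬; pigeonhole)
open import Data.Fin.Subset
  using (Subset; _∈_; _∉_; _⊆_; _∪_; ⁅_⁆; Nonempty)
  renaming (⊥ to ∅; ∣_∣ to card; _-_ to _∖_)
open import Data.Fin.Subset.Properties
  using ( _∈?_; nonempty?; Empty-unique; ∉⊥; ∣⊥∣≡0; ⊆-refl; ⊆-antisym; out⊆; in⊆in; drop-there
        ; x∈p∪q⁻; x∈p∪q⁺; p⊆p∪q; q⊆p∪q; x∈⁅x⁆; x∈⁅y⁆⇒x≡y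
        ; p─⊥≡p; p─q⊆p; x∈p∧x≢y⇒x∈p-y )
open import Data.Vec using ([]; _∷_; here; there; lookup; tabulate; _[_]%=_)
open import Data.Vec.Properties
  using ([]=⇒lookup; lookup⇒[]=; lookup∘tabulate; tabulate∘lookup; updateAt-minimal)
open import Data.List using (List; []; _∷_; _++_; map; foldr; allFin; length)
import Data.List
import Data.List.Properties as List
open import Data.List.Membership.Propositional using () renaming (_∈_ to _∈ₗ_; _∉_ to _∉ₗ_)
open import Data.List.Membership.Propositional.Properties using (∈-allFin)
open import Data.List.Relation.Unary.All using (All; []; _∷_)
import Data.List.Relation.Unary.All as All
import Data.List.Relation.Unary.Any as Any
open import Data.List.Relation.Unary.Any.Properties using (any⇔; tabulate⁺; tabulate⁻)
open import Data.Product using (Σ; ∃; _×_; _,_; proj₁; proj₂)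
open import Data.Product.Function.NonDependent.Propositional using (_×-⇔_)
open import Data.Sum using (_⊎_; inj₁; inj₂; [_,_]′)
import Data.Sum as Sum
open import Data.Sum.Function.Propositional using (_⊎-⇔_)
open import Data.Unit using (tt)
open import Data.Empty using (⊥-elim)
open import Data.Rational using (ℚ; 0ℚ; 1ℚ; _+_; _*_; -_; _-_)
open import Data.Rational.Properties
  using ( +-identityˡ; +-identityʳ; +-assoc; +-inverseʳ
        ; *-zeroˡ; *-zeroʳ; *-identityˡ; *-identityʳ; *-distribˡ-+ )
open import Data.Rational.Solver using (module +-*-Solver)
open import Function using (_∘_; id; const; case_of_; _⇔_; mk⇔; Equivalence)
import Function.Properties.Equivalence as ⇔
open import Function.Related.TypeIsomorphisms using (¬-cong-⇔)
open import Relation.Unary using (Decidable)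
open import Relation.Nullary using (Dec; yes; no; does; ¬_; ¬?)
open import Relation.Nullary.Decidable
  using (_×-dec_; _⊎-dec_; _→-dec_; map′; dec-true; dec-false; does-⇔; decidable-stable)
import Relation.Nullary.Decidable as Dec
open import Relation.Binary.PropositionalEquality

open +-*-Solver using (solve; _:+_; _:*_; _:-_; :-_; _:=_; con)
open Equivalence using (to; from)

_⇔?_ : ∀ {A B : Set} → Dec A → Dec B → Dec (A ⇔ B)
A? ⇔? B? =
  map′ (λ (f , g) → mk⇔ f g) (λ A⇔B → to A⇔B , from A⇔B) ((A? →-dec B?) ×-dec (B? →-dec A?))

𝟙 : ∀ {P : Set} → Dec P → ℚ
𝟙 P? = bitℚ (does P?)

𝟙-yes : ∀ {P : Set} (P? : Dec P) → P → 𝟙 P? ≡ 1ℚ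
𝟙-yes P? p = cong bitℚ (dec-true P? p)

𝟙-no : ∀ {P : Set} (P? : Dec P) → ¬ P → 𝟙 P? ≡ 0ℚ
𝟙-no P? ¬p = cong bitℚ (dec-false P? ¬p)

𝟙-cong : ∀ {P Q : Set} → P ⇔ Q → (P? : Dec P) (Q? : Dec Q) → 𝟙 P? ≡ 𝟙 Q?
𝟙-cong P⇔Q P? Q? = cong bitℚ (does-⇔ P⇔Q P? Q?)

𝟙-¬ : ∀ {P : Set} (P? : Dec P) → 𝟙 P? ≡ 1ℚ - 𝟙 (¬? P?)
𝟙-¬ (yes _) = refl
𝟙-¬ (no _) = refl

𝟙-× : ∀ {P Q : Set} (P? : Dec P) (Q? : Dec Q) → 𝟙 P? * 𝟙 Q? ≡ 𝟙 (P? ×-dec Q?)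
𝟙-× (yes _) Q? = *-identityˡ (𝟙 Q?)
𝟙-× (no _) Q? = *-zeroˡ (𝟙 Q?)

𝟙-split : ∀ {P : Set} (P? : Dec P) x → x ≡ 𝟙 P? * x + 𝟙 (¬? P?) * x
𝟙-split (yes _) = solve 1 (λ x → x := con 1ℚ :* x :+ con 0ℚ :* x) refl
𝟙-split (no _) = solve 1 (λ x → x := con 0ℚ :* x :+ con 1ℚ :* x) refl

𝟙-absorb : ∀ {P : Set} (P? : Dec P) {x} → (P → x ≡ 1ℚ) → 𝟙 P? ≡ 𝟙 P? * x
𝟙-absorb (yes p) {x} x≡1 = sym (trans (*-identityˡ x) (x≡1 p))
𝟙-absorb (no _) {x} _ = sym (*-zeroˡ x)

-- Möbius inversion on the Boolean lattice

-- ζ c X = Σ_{S ⊆ X} c S is the value at the indicator vector of X of the multilinear polynomial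
-- with coefficients c, and μ f H = Σ_{S ⊆ H} (-1)^{|H ∖ S|} f S inverts it.
ζ : ∀ {m} → (Subset m → ℚ) → Subset m → ℚ
ζ c [] = c []
ζ c (false ∷ X) = ζ (c ∘ (false ∷_)) X
ζ c (true ∷ X) = ζ (c ∘ (false ∷_)) X + ζ (c ∘ (true ∷_)) X

μ : ∀ {m} → (Subset m → ℚ) → Subset m → ℚ
μ f [] = f []
μ f (false ∷ H) = μ (f ∘ (false ∷_)) H
μ f (true ∷ H) = μ (f ∘ (true ∷_)) H - μ (f ∘ (false ∷_)) H

μ-cong-⊆ : ∀ {m} {f g : Subset m → ℚ} H → (∀ {S} → S ⊆ H → f S ≡ g S) → μ f H ≡ μ g H
μ-cong-⊆ [] f≗g = f≗g ⊆-refl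
μ-cong-⊆ (false ∷ H) f≗g = μ-cong-⊆ H (f≗g ∘ out⊆)
μ-cong-⊆ (true ∷ H) f≗g = cong₂ _-_ (μ-cong-⊆ H (f≗g ∘ in⊆in)) (μ-cong-⊆ H (f≗g ∘ out⊆))

μ-cong : ∀ {m} {f g : Subset m → ℚ} → (∀ S → f S ≡ g S) → ∀ H → μ f H ≡ μ g H
μ-cong f≗g H = μ-cong-⊆ H (λ {S} _ → f≗g S)

+-─-interchange : ∀ a b c d → (a - b) + (c - d) ≡ (a + c) - (b + d)
+-─-interchange = solve 4 (λ a b c d → (a :- b) :+ (c :- d) := (a :+ c) :- (b :+ d)) refl

─-─-interchange : ∀ a b c d → (a - b) - (c - d) ≡ (a - c) - (b - d)
─-─-interchange = solve 4 (λ a b c d → (a :- b) :- (c :- d) := (a :- c) :- (b :- d)) refl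

ζ-─ : ∀ {m} (c d : Subset m → ℚ) X → ζ (λ S → c S - d S) X ≡ ζ c X - ζ d X
ζ-─ c d [] = refl
ζ-─ c d (false ∷ X) = ζ-─ (c ∘ (false ∷_)) (d ∘ (false ∷_)) X
ζ-─ c d (true ∷ X) =
  trans (cong₂ _+_ (ζ-─ c₀ d₀ X) (ζ-─ c₁ d₁ X))
        (+-─-interchange (ζ c₀ X) (ζ d₀ X) (ζ c₁ X) (ζ d₁ X))
  where
  c₀ c₁ d₀ d₁ : _ → ℚ
  c₀ = c ∘ (false ∷_)
  c₁ = c ∘ (true ∷_)
  d₀ = d ∘ (false ∷_)
  d₁ = d ∘ (true ∷_)

μ-+ : ∀ {m} (f g : Subset m → ℚ) H → μ (λ S → f S + g S) H ≡ μ f H + μ g H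
μ-+ f g [] = refl
μ-+ f g (false ∷ H) = μ-+ (f ∘ (false ∷_)) (g ∘ (false ∷_)) H
μ-+ f g (true ∷ H) =
  trans (cong₂ _-_ (μ-+ f₁ g₁ H) (μ-+ f₀ g₀ H))
        (sym (+-─-interchange (μ f₁ H) (μ f₀ H) (μ g₁ H) (μ g₀ H)))
  where
  f₀ f₁ g₀ g₁ : _ → ℚ
  f₀ = f ∘ (false ∷_)
  f₁ = f ∘ (true ∷_)
  g₀ = g ∘ (false ∷_)
  g₁ = g ∘ (true ∷_)

μ-─ : ∀ {m} (f g : Subset m → ℚ) H → μ (λ S → f S - g S) H ≡ μ f H - μ g H
μ-─ f g [] = refl
μ-─ f g (false ∷ H) = μ-─ (f ∘ (false ∷_)) (g ∘ (false ∷_)) H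
μ-─ f g (true ∷ H) =
  trans (cong₂ _-_ (μ-─ f₁ g₁ H) (μ-─ f₀ g₀ H))
        (─-─-interchange (μ f₁ H) (μ g₁ H) (μ f₀ H) (μ g₀ H))
  where
  f₀ f₁ g₀ g₁ : _ → ℚ
  f₀ = f ∘ (false ∷_)
  f₁ = f ∘ (true ∷_)
  g₀ = g ∘ (false ∷_)
  g₁ = g ∘ (true ∷_)

ζ∘μ : ∀ {m} (f : Subset m → ℚ) X → ζ (μ f) X ≡ f X
ζ∘μ f [] = refl
ζ∘μ f (false ∷ X) = ζ∘μ (f ∘ (false ∷_)) X
ζ∘μ f (true ∷ X) = begin
  ζ (μ f₀) X + ζ (λ S → μ f₁ S - μ f₀ S) X
    ≡⟨ cong (ζ (μ f₀) X +_) (ζ-─ (μ f₁) (μ f₀) X) ⟩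
  ζ (μ f₀) X + (ζ (μ f₁) X - ζ (μ f₀) X)
    ≡⟨ cong₂ (λ a b → a + (b - a)) (ζ∘μ f₀ X) (ζ∘μ f₁ X) ⟩
  f₀ X + (f₁ X - f₀ X)
    ≡⟨ solve 2 (λ a b → a :+ (b :- a) := b) refl (f₀ X) (f₁ X) ⟩
  f₁ X ∎
  where
  open ≡-Reasoning
  f₀ f₁ : _ → ℚ
  f₀ = f ∘ (false ∷_)
  f₁ = f ∘ (true ∷_)

μ∘ζ : ∀ {m} (c : Subset m → ℚ) H → μ (ζ c) H ≡ c H
μ∘ζ c [] = refl
μ∘ζ c (false ∷ H) = μ∘ζ (c ∘ (false ∷_)) H
μ∘ζ c (true ∷ H) = begin
  μ (λ S → ζ c₀ S + ζ c₁ S) H - μ (ζ c₀) H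
    ≡⟨ cong (_- μ (ζ c₀) H) (μ-+ (ζ c₀) (ζ c₁) H) ⟩
  μ (ζ c₀) H + μ (ζ c₁) H - μ (ζ c₀) H
    ≡⟨ cong₂ (λ a b → a + b - a) (μ∘ζ c₀ H) (μ∘ζ c₁ H) ⟩
  c₀ H + c₁ H - c₀ H
    ≡⟨ solve 2 (λ a b → a :+ b :- a := b) refl (c₀ H) (c₁ H) ⟩
  c₁ H ∎
  where
  open ≡-Reasoning
  c₀ c₁ : _ → ℚ
  c₀ = c ∘ (false ∷_)
  c₁ = c ∘ (true ∷_)

μ-∅ : ∀ {m} (f : Subset m → ℚ) → μ f ∅ ≡ f ∅
μ-∅ {zero} f = refl
μ-∅ {suc m} f = μ-∅ (f ∘ (false ∷_))

μ-0 : ∀ {m} (H : Subset m) → μ (λ _ → 0ℚ) H ≡ 0ℚ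
μ-0 [] = refl
μ-0 (false ∷ H) = μ-0 H
μ-0 (true ∷ H) = +-inverseʳ (μ (λ _ → 0ℚ) H)

μ-const : ∀ {m} x (H : Subset m) → Nonempty H → μ (λ _ → x) H ≡ 0ℚ
μ-const x (true ∷ H) _ = +-inverseʳ (μ (λ _ → x) H)
μ-const x (false ∷ H) (suc e , there e∈H) = μ-const x H (e , e∈H)

-- Sign-reversing involutions

toggle : ∀ {m} → Subset m → Fin m → Subset m
toggle S e = S [ e ]%= not

∈-toggle⁺ : ∀ {m} {a e : Fin m} (S : Subset m) → a ≢ e → a ∈ S → a ∈ toggle S e
∈-toggle⁺ {a = a} {e} S = updateAt-minimal a e S

∈-toggle⁻ : ∀ {m} {a e : Fin m} (S : Subset m) → a ≢ e → a ∈ toggle S e → a ∈ S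
∈-toggle⁻ {a = zero} {zero} _ a≢e _ = ⊥-elim (a≢e refl)
∈-toggle⁻ {a = zero} {suc e} (_ ∷ S) _ here = here
∈-toggle⁻ {a = suc a} {zero} (_ ∷ S) _ (there a∈S) = there a∈S
∈-toggle⁻ {a = suc a} {suc e} (_ ∷ S) a≢e (there a∈) = there (∈-toggle⁻ S (a≢e ∘ cong suc) a∈)

toggle-⊆ : ∀ {m} {e : Fin m} {S H : Subset m} → S ⊆ H → e ∈ H → toggle S e ⊆ H
toggle-⊆ {e = e} {S} S⊆H e∈H {a} a∈ with a ≟ e
... | yes refl = e∈H
... | no a≢e = S⊆H (∈-toggle⁻ S a≢e a∈)

record TogglingInvolution {m} (H : Subset m) (h : Subset m → ℚ) : Set₁ where
  field
    Toggleable        : Subset m → Fin m → Set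
    toggleable?       : ∀ S → Decidable (Toggleable S)
    toggleable⇒∈      : ∀ {S e} → Toggleable S e → e ∈ H
    toggleable-stable : ∀ {S e} → S ⊆ H → Toggleable S e →
                        ∀ e′ → Toggleable (toggle S e) e′ ⇔ Toggleable S e′
    h-stable          : ∀ {S e} → S ⊆ H → Toggleable S e → h (toggle S e) ≡ h S
    h-vanishes        : ∀ {S} → S ⊆ H → ¬ ∃ (Toggleable S) → h S ≡ 0ℚ

module FirstArc {m b} {H : Subset m} {h} (T : TogglingInvolution (b ∷ H) h) where
  open TogglingInvolution T

  h₀ h₊ : Subset (suc m) → ℚ
  h₀ S = 𝟙 (toggleable? S zero) * h S
  h₊ S = 𝟙 (¬? (toggleable? S zero)) * h S

  μ-h₀+h₊ : μ h (b ∷ H) ≡ μ h₀ (b ∷ H) + μ h₊ (b ∷ H)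
  μ-h₀+h₊ = trans (μ-cong (λ S → 𝟙-split (toggleable? S zero) (h S)) (b ∷ H)) (μ-+ h₀ h₊ (b ∷ H))

  h₀-vanishes : zero ∉ b ∷ H → ∀ S → h₀ S ≡ 0ℚ
  h₀-vanishes 0∉H S =
    trans (cong (_* h S) (𝟙-no (toggleable? S zero) (0∉H ∘ toggleable⇒∈))) (*-zeroˡ (h S))

  h₀-paired : ∀ {S} → false ∷ S ⊆ b ∷ H → true ∷ S ⊆ b ∷ H →
              h₀ (true ∷ S) ≡ h₀ (false ∷ S)
  h₀-paired {S} S₀⊆H S₁⊆H with toggleable? (false ∷ S) zero | toggleable? (true ∷ S) zero
  ... | yes t₀ | yes _  = cong (1ℚ *_) (h-stable S₀⊆H t₀)
  ... | yes t₀ | no ¬t₁ = ⊥-elim (¬t₁ (from (toggleable-stable S₀⊆H t₀ zero) t₀))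
  ... | no ¬t₀ | yes t₁ = ⊥-elim (¬t₀ (from (toggleable-stable S₁⊆H t₁ zero) t₁))
  ... | no _   | no _   = trans (*-zeroˡ (h (true ∷ S))) (sym (*-zeroˡ (h (false ∷ S))))

  restrict : ∀ c → (∀ {S} → S ⊆ H → c ∷ S ⊆ b ∷ H) → TogglingInvolution H (h₊ ∘ (c ∷_))
  restrict c lift = record
    { Toggleable = λ S e → ¬ Toggleable (c ∷ S) zero × Toggleable (c ∷ S) (suc e)
    ; toggleable? = λ S e → ¬? (toggleable? (c ∷ S) zero) ×-dec toggleable? (c ∷ S) (suc e)
    ; toggleable⇒∈ = λ (_ , t) → drop-there (toggleable⇒∈ t)
    ; toggleable-stable = λ S⊆H (_ , t) e′ →
        ¬-cong-⇔ (toggleable-stable (lift S⊆H) t zero) ×-⇔ toggleable-stable (lift S⊆H) t (suc e′)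
    ; h-stable = λ {S} {e} S⊆H (_ , t) → cong₂ _*_
        (𝟙-cong (¬-cong-⇔ (toggleable-stable (lift S⊆H) t zero))
                (¬? (toggleable? (c ∷ toggle S e) zero)) (¬? (toggleable? (c ∷ S) zero)))
        (h-stable (lift S⊆H) t)
    ; h-vanishes = vanishes
    }
    where
    vanishes : ∀ {S} → S ⊆ H →
               ¬ ∃ (λ e → ¬ Toggleable (c ∷ S) zero × Toggleable (c ∷ S) (suc e)) → h₊ (c ∷ S) ≡ 0ℚ
    vanishes {S} S⊆H none with toggleable? (c ∷ S) zero
    ... | yes _ = *-zeroˡ (h (c ∷ S))
    ... | no ¬t₀ = trans (*-identityˡ (h (c ∷ S))) (h-vanishes (lift S⊆H) λ
      { (zero , t₀) → ¬t₀ t₀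
      ; (suc e , t) → none (e , ¬t₀ , t) })

-- Toggling the first toggleable arc is a sign-reversing involution on the support of h
-- which preserves h.
μ-toggling : ∀ {m} {H : Subset m} {h} → TogglingInvolution H h → μ h H ≡ 0ℚ
μ-toggling {H = []} T = h-vanishes ⊆-refl (λ { (() , _) })
  where open TogglingInvolution T
μ-toggling {H = false ∷ H} {h} T = begin
  μ h (false ∷ H)                      ≡⟨ μ-h₀+h₊ ⟩
  μ h₀ (false ∷ H) + μ h₊ (false ∷ H)  ≡⟨ cong₂ _+_ μ-h₀ (μ-toggling (restrict false out⊆)) ⟩
  0ℚ + 0ℚ                              ≡⟨ +-identityʳ 0ℚ ⟩
  0ℚ                                   ∎
  where
  open ≡-Reasoning
  open FirstArc T
  μ-h₀ : μ h₀ (false ∷ H) ≡ 0ℚ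
  μ-h₀ = trans (μ-cong (h₀-vanishes (λ ()) ∘ (false ∷_)) H) (μ-0 H)
μ-toggling {H = true ∷ H} {h} T = begin
  μ h (true ∷ H)                     ≡⟨ μ-h₀+h₊ ⟩
  μ h₀ (true ∷ H) + μ h₊ (true ∷ H)  ≡⟨ cong₂ _+_ μ-h₀ μ-h₊ ⟩
  0ℚ + 0ℚ                            ≡⟨ +-identityʳ 0ℚ ⟩
  0ℚ                                 ∎
  where
  open ≡-Reasoning
  open FirstArc T
  μ-h₀ : μ h₀ (true ∷ H) ≡ 0ℚ
  μ-h₀ = trans (cong (_- μ (h₀ ∘ (false ∷_)) H) (μ-cong-⊆ H λ S⊆H → h₀-paired (out⊆ S⊆H) (in⊆in S⊆H)))
               (+-inverseʳ (μ (h₀ ∘ (false ∷_)) H))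
  μ-h₊ : μ h₊ (true ∷ H) ≡ 0ℚ
  μ-h₊ = cong₂ _-_ (μ-toggling (restrict true in⊆in)) (μ-toggling (restrict false out⊆))

-- Evaluation at Boolean points

sumℚ-++ : ∀ xs ys → sumℚ (xs ++ ys) ≡ sumℚ xs + sumℚ ys
sumℚ-++ [] ys = sym (+-identityˡ (sumℚ ys))
sumℚ-++ (x ∷ xs) ys = trans (cong (x +_) (sumℚ-++ xs ys)) (sym (+-assoc x (sumℚ xs) (sumℚ ys)))

sumℚ-* : ∀ a xs → sumℚ (map (a *_) xs) ≡ a * sumℚ xs
sumℚ-* a [] = sym (*-zeroʳ a)
sumℚ-* a (x ∷ xs) = trans (cong (a * x +_) (sumℚ-* a xs)) (sym (*-distribˡ-+ a x (sumℚ xs)))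

monomial-∷ : ∀ {m} b (S : Subset m) (x : Fin (suc m) → ℚ) →
  monomial (b ∷ S) x ≡ (if b then x zero else 1ℚ) * monomial S (x ∘ suc)
monomial-∷ {m} b S x = cong ((if b then x zero else 1ℚ) *_) (begin
  foldr factor 1ℚ (Data.List.tabulate suc)  ≡⟨ cong (foldr factor 1ℚ) (sym (List.map-tabulate id suc)) ⟩
  foldr factor 1ℚ (map suc (allFin m))      ≡⟨ List.foldr-map factor suc 1ℚ (allFin m) ⟩
  monomial S (x ∘ suc)                      ∎)
  where
  open ≡-Reasoning
  factor : Fin (suc m) → ℚ → ℚ
  factor e acc = (if lookup (b ∷ S) e then x e else 1ℚ) * acc

eval-∷ : ∀ {m} (c : Subset (suc m) → ℚ) (x : Fin (suc m) → ℚ) →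
  eval c x ≡ eval (c ∘ (false ∷_)) (x ∘ suc) + x zero * eval (c ∘ (true ∷_)) (x ∘ suc)
eval-∷ {m} c x = begin
  sumℚ (map term (map (false ∷_) A ++ map (true ∷_) A))
    ≡⟨ cong sumℚ (List.map-++ term (map (false ∷_) A) (map (true ∷_) A)) ⟩
  sumℚ (map term (map (false ∷_) A) ++ map term (map (true ∷_) A))
    ≡⟨ sumℚ-++ (map term (map (false ∷_) A)) (map term (map (true ∷_) A)) ⟩
  sumℚ (map term (map (false ∷_) A)) + sumℚ (map term (map (true ∷_) A))
    ≡⟨ cong₂ _+_ (cong sumℚ (trans (sym (List.map-∘ A)) (List.map-cong term₀ A)))
                 (cong sumℚ (trans (sym (List.map-∘ A)) (trans (List.map-cong term₁ A) (List.map-∘ A)))) ⟩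
  eval (c ∘ (false ∷_)) (x ∘ suc) + sumℚ (map (x zero *_) (map term′ A))
    ≡⟨ cong (eval (c ∘ (false ∷_)) (x ∘ suc) +_) (sumℚ-* (x zero) (map term′ A)) ⟩
  eval (c ∘ (false ∷_)) (x ∘ suc) + x zero * eval (c ∘ (true ∷_)) (x ∘ suc) ∎
  where
  open ≡-Reasoning
  A = allSubsets m
  term : Subset (suc m) → ℚ
  term S = c S * monomial S x
  term′ : Subset m → ℚ
  term′ S = c (true ∷ S) * monomial S (x ∘ suc)
  term₀ : ∀ S → term (false ∷ S) ≡ c (false ∷ S) * monomial S (x ∘ suc)
  term₀ S = cong (c (false ∷ S) *_) (trans (monomial-∷ false S x) (*-identityˡ (monomial S (x ∘ suc))))
  term₁ : ∀ S → term (true ∷ S) ≡ x zero * term′ S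
  term₁ S = trans (cong (c (true ∷ S) *_) (monomial-∷ true S x))
    (solve 3 (λ a b d → a :* (b :* d) := b :* (a :* d)) refl (c (true ∷ S)) (x zero) (monomial S (x ∘ suc)))

eval-bits : ∀ {m} (c : Subset m → ℚ) (x : Fin m → Bool) → eval c (bitℚ ∘ x) ≡ ζ c (tabulate x)
eval-bits {zero} c x = trans (+-identityʳ (c [] * 1ℚ)) (*-identityʳ (c []))
eval-bits {suc m} c x = begin
  eval c (bitℚ ∘ x)
    ≡⟨ eval-∷ c (bitℚ ∘ x) ⟩
  eval c₀ (bitℚ ∘ x ∘ suc) + bitℚ (x zero) * eval c₁ (bitℚ ∘ x ∘ suc)
    ≡⟨ cong₂ (λ a b → a + bitℚ (x zero) * b) (eval-bits c₀ (x ∘ suc)) (eval-bits c₁ (x ∘ suc)) ⟩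
  ζ c₀ X + bitℚ (x zero) * ζ c₁ X
    ≡⟨ by-bit (x zero) ⟩
  ζ c (x zero ∷ X) ∎
  where
  open ≡-Reasoning
  X = tabulate (x ∘ suc)
  c₀ c₁ : Subset m → ℚ
  c₀ = c ∘ (false ∷_)
  c₁ = c ∘ (true ∷_)
  by-bit : ∀ b → ζ c₀ X + bitℚ b * ζ c₁ X ≡ ζ c (b ∷ X)
  by-bit false = trans (cong (ζ c₀ X +_) (*-zeroˡ (ζ c₁ X))) (+-identityʳ (ζ c₀ X))
  by-bit true = cong (ζ c₀ X +_) (*-identityˡ (ζ c₁ X))

∈⇔lookup : ∀ {k} {x : Fin k} {X : Subset k} → x ∈ X ⇔ lookup X x ≡ true
∈⇔lookup {x = x} {X} = mk⇔ []=⇒lookup (lookup⇒[]= x X)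

∈-tabulate : ∀ {k} {x : Fin k} {f : Fin k → Bool} → x ∈ tabulate f ⇔ f x ≡ true
∈-tabulate {x = x} {f} =
  ⇔.trans ∈⇔lookup (mk⇔ (trans (sym (lookup∘tabulate f x))) (trans (lookup∘tabulate f x)))

x∉p∖x : ∀ {k} (x : Fin k) (p : Subset k) → x ∉ p ∖ x
x∉p∖x zero (_ ∷ p) ()
x∉p∖x (suc x) (_ ∷ p) (there x∈) = x∉p∖x x p x∈

x∉p⇒p∖x≡p : ∀ {k} {x : Fin k} {p : Subset k} → x ∉ p → p ∖ x ≡ p
x∉p⇒p∖x≡p {x = x} {p} x∉p =
  ⊆-antisym (p─q⊆p p ⁅ x ⁆) (λ y∈p → x∈p∧x≢y⇒x∈p-y y∈p (λ { refl → x∉p y∈p }))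

module _ {A : Set} {k : ℕ} (F : A → Subset k) where

  unionOf : List A → Subset k
  unionOf = foldr (λ a acc → F a ∪ acc) ∅

  ∈-unionOf⁻ : ∀ {x} B → x ∈ unionOf B → ∃ λ a → x ∈ F a × F a ⊆ unionOf B
  ∈-unionOf⁻ [] x∈ = ⊥-elim (∉⊥ x∈)
  ∈-unionOf⁻ (a ∷ B) x∈ with x∈p∪q⁻ (F a) (unionOf B) x∈
  ... | inj₁ x∈a = a , x∈a , p⊆p∪q (unionOf B)
  ... | inj₂ x∈B =
    let (a′ , x∈a′ , a′⊆B) = ∈-unionOf⁻ B x∈B in a′ , x∈a′ , q⊆p∪q (F a) (unionOf B) ∘ a′⊆B

  unionOf-cover : ∀ {H} → (∀ {x} → x ∈ H → ∃ λ a → x ∈ F a × F a ⊆ H) →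
                  ∃ λ B → unionOf B ≡ H
  unionOf-cover {H} covered =
    let (B , B⊆H , H⊆B) = collect (allFin k) in B , ⊆-antisym B⊆H (λ {x} → H⊆B (∈-allFin x))
    where
    collect : (L : List (Fin k)) →
              ∃ λ B → unionOf B ⊆ H × (∀ {x} → x ∈ₗ L → x ∈ H → x ∈ unionOf B)
    collect [] = [] , (⊥-elim ∘ ∉⊥) , λ ()
    collect (x ∷ L) with x ∈? H | collect L
    ... | no x∉H | B , B⊆H , L⊆B =
      B , B⊆H , λ { (Any.here refl) x∈H → ⊥-elim (x∉H x∈H) ; (Any.there y∈L) → L⊆B y∈L }
    ... | yes x∈H | B , B⊆H , L⊆B =
      let (a , x∈a , a⊆H) = covered x∈H
      in a ∷ B , [ a⊆H , B⊆H ]′ ∘ x∈p∪q⁻ (F a) (unionOf B)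
               , λ { (Any.here refl) _ → p⊆p∪q (unionOf B) x∈a
                   ; (Any.there y∈L) y∈H → q⊆p∪q (F a) (unionOf B) (L⊆B y∈L y∈H) }

ε : ∀ {k} → Subset k → ℚ
ε S = neg1^ (card S)

ε-∅ : ∀ k → ε (∅ {k}) ≡ 1ℚ
ε-∅ k = cong neg1^ (∣⊥∣≡0 k)

ε-∖ : ∀ {k} {x : Fin k} {p : Subset k} → x ∈ p → ε p ≡ - ε (p ∖ x)
ε-∖ {x = zero} {true ∷ p} here = cong (-_ ∘ ε) (sym (p─⊥≡p p))
ε-∖ {x = suc x} {true ∷ p} (there x∈p) = cong -_ (ε-∖ x∈p)
ε-∖ {x = suc x} {false ∷ p} (there x∈p) = ε-∖ x∈p

-- Arcs grouped by their heads

Enters : ∀ {n m} → (Fin m → Fin n) → Subset m → Fin n → Set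
Enters hd S v = ∃ λ a → a ∈ S × hd a ≡ v

enters? : ∀ {n m} (hd : Fin m → Fin n) S v → Dec (Enters hd S v)
enters? hd S v = any? (λ a → (a ∈? S) ×-dec (hd a ≟ v))

enters-false : ∀ {n m} {hd : Fin (suc m) → Fin n} {S v} →
  Enters hd (false ∷ S) v ⇔ Enters (hd ∘ suc) S v
enters-false = mk⇔ (λ { (suc a , there a∈S , eq) → a , a∈S , eq })
                   (λ (a , a∈S , eq) → suc a , there a∈S , eq)

enters-true : ∀ {n m} {hd : Fin (suc m) → Fin n} {S v} →
  Enters hd (true ∷ S) v ⇔ (hd zero ≡ v ⊎ Enters (hd ∘ suc) S v)
enters-true = mk⇔
  (λ { (zero , here , eq) → inj₁ eq ; (suc a , there a∈S , eq) → inj₂ (a , a∈S , eq) })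
  (λ { (inj₁ eq) → zero , here , eq ; (inj₂ (a , a∈S , eq)) → suc a , there a∈S , eq })

-- Arcs are seen only through their heads hd, so that μ-covers can induct on the arcs.
module HeadSets {n : ℕ} (t : Fin n) where

  Covers : ∀ {m} → (Fin m → Fin n) → Subset n → Subset m → Set
  Covers hd J S = ¬ Enters hd S t × (∀ v → v ∈ J → Enters hd S v)

  covers? : ∀ {m} (hd : Fin m → Fin n) J S → Dec (Covers hd J S)
  covers? hd J S = ¬? (enters? hd S t) ×-dec all? (λ v → (v ∈? J) →-dec enters? hd S v)

  InnerHead : ∀ {m} → (Fin m → Fin n) → Subset m → Fin n → Set
  InnerHead hd H v = v ≢ t × Enters hd H v

  innerHead? : ∀ {m} (hd : Fin m → Fin n) H v → Dec (InnerHead hd H v)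
  innerHead? hd H v = ¬? (v ≟ t) ×-dec enters? hd H v

  IsInnerHeadSet : ∀ {m} → (Fin m → Fin n) → Subset m → Subset n → Set
  IsInnerHeadSet hd H J = ∀ v → v ∈ J ⇔ InnerHead hd H v

  isInnerHeadSet? : ∀ {m} (hd : Fin m → Fin n) H J → Dec (IsInnerHeadSet hd H J)
  isInnerHeadSet? hd H J = all? (λ v → (v ∈? J) ⇔? innerHead? hd H v)

  covers-[] : ∀ {hd : Fin 0 → Fin n} {J} → Covers hd J [] ⇔ IsInnerHeadSet hd [] J
  covers-[] = mk⇔
    (λ (_ , covered) v →
       mk⇔ (λ v∈J → ⊥-elim (nothing-enters (covered v v∈J))) (⊥-elim ∘ nothing-enters ∘ proj₂))
    (λ hs → nothing-enters , λ v v∈J → ⊥-elim (nothing-enters (proj₂ (to (hs v) v∈J))))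
    where
    nothing-enters : ∀ {hd : Fin 0 → Fin n} {v} → ¬ Enters hd [] v
    nothing-enters (() , _)

  covers-false : ∀ {m} {hd : Fin (suc m) → Fin n} {J S} → Covers hd J (false ∷ S) ⇔ Covers (hd ∘ suc) J S
  covers-false = mk⇔ (λ (¬t , covered) → ¬t ∘ from enters-false , λ v → to enters-false ∘ covered v)
                     (λ (¬t , covered) → ¬t ∘ to enters-false , λ v → from enters-false ∘ covered v)

  covers-true-t : ∀ {m} {hd : Fin (suc m) → Fin n} {J S} → hd zero ≡ t → ¬ Covers hd J (true ∷ S)
  covers-true-t v₀≡t (¬t , _) = ¬t (zero , here , v₀≡t)

  covers-true : ∀ {m} {hd : Fin (suc m) → Fin n} {J S} → hd zero ≢ t →
    Covers hd J (true ∷ S) ⇔ Covers (hd ∘ suc) (J ∖ hd zero) S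
  covers-true {hd = hd} {J} v₀≢t = mk⇔
    (λ (¬t , covered) → ¬t ∘ from enters-true ∘ inj₂ , λ v v∈J∖v₀ →
       [ (λ { refl → ⊥-elim (x∉p∖x (hd zero) J v∈J∖v₀) }) , id ]′
         (to enters-true (covered v (p─q⊆p J ⁅ hd zero ⁆ v∈J∖v₀))))
    (λ (¬t , covered) →
       [ v₀≢t , ¬t ]′ ∘ to enters-true , λ v v∈J → from enters-true (enter v v∈J covered))
    where
    enter : ∀ {S} v → v ∈ J → (∀ v → v ∈ J ∖ hd zero → Enters (hd ∘ suc) S v) →
            hd zero ≡ v ⊎ Enters (hd ∘ suc) S v
    enter v v∈J covered with hd zero ≟ v
    ... | yes v₀≡v = inj₁ v₀≡v
    ... | no v₀≢v = inj₂ (covered v (x∈p∧x≢y⇒x∈p-y v∈J (v₀≢v ∘ sym)))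

  headSet-cong : ∀ {m m′} {hd : Fin m → Fin n} {hd′ : Fin m′ → Fin n} {H H′ J} →
    (∀ {v} → InnerHead hd H v ⇔ InnerHead hd′ H′ v) → IsInnerHeadSet hd H J ⇔ IsInnerHeadSet hd′ H′ J
  headSet-cong same = mk⇔ (λ hs v → ⇔.trans (hs v) same) (λ hs v → ⇔.trans (hs v) (⇔.sym same))

  innerHead-false : ∀ {m} {hd : Fin (suc m) → Fin n} {H v} →
    InnerHead hd (false ∷ H) v ⇔ InnerHead (hd ∘ suc) H v
  innerHead-false = mk⇔ (λ (v≢t , e) → v≢t , to enters-false e)
                        (λ (v≢t , e) → v≢t , from enters-false e)

  innerHead-true-t : ∀ {m} {hd : Fin (suc m) → Fin n} {H v} → hd zero ≡ t →
    InnerHead hd (true ∷ H) v ⇔ InnerHead (hd ∘ suc) H v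
  innerHead-true-t v₀≡t = mk⇔
    (λ (v≢t , e) →
       v≢t , [ (λ v₀≡v → ⊥-elim (v≢t (trans (sym v₀≡v) v₀≡t))) , id ]′ (to enters-true e))
    (λ (v≢t , e) → v≢t , from enters-true (inj₂ e))

  innerHead-true : ∀ {m} {hd : Fin (suc m) → Fin n} {H v} → hd zero ≢ t →
    InnerHead hd (true ∷ H) v ⇔ (hd zero ≡ v ⊎ InnerHead (hd ∘ suc) H v)
  innerHead-true v₀≢t = mk⇔
    (λ (v≢t , e) → Sum.map₂ (v≢t ,_) (to enters-true e))
    (λ { (inj₁ refl) → v₀≢t , zero , here , refl
       ; (inj₂ (v≢t , e)) → v≢t , from enters-true (inj₂ e) })

  module _ {m} {hd : Fin (suc m) → Fin n} {H : Subset m} {J : Subset n} (v₀≢t : hd zero ≢ t) where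
    private
      v₀ = hd zero
      hd′ = hd ∘ suc

    headSet-old-head : InnerHead hd′ H v₀ → IsInnerHeadSet hd (true ∷ H) J ⇔ IsInnerHeadSet hd′ H J
    headSet-old-head ih₀ = headSet-cong (mk⇔
      ([ (λ { refl → ih₀ }) , id ]′ ∘ to (innerHead-true v₀≢t))
      (from (innerHead-true v₀≢t) ∘ inj₂))

    headSet-new-head : ¬ InnerHead hd′ H v₀ → v₀ ∈ J →
      IsInnerHeadSet hd (true ∷ H) J ⇔ IsInnerHeadSet hd′ H (J ∖ v₀)
    headSet-new-head ¬ih₀ v₀∈J = mk⇔
      (λ hs v → mk⇔
        (λ v∈J∖v₀ → [ (λ { refl → ⊥-elim (x∉p∖x v₀ J v∈J∖v₀) }) , id ]′
                       (to (innerHead-true v₀≢t) (to (hs v) (p─q⊆p J ⁅ v₀ ⁆ v∈J∖v₀))))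
        (λ ih → x∈p∧x≢y⇒x∈p-y (from (hs v) (from (innerHead-true v₀≢t) (inj₂ ih)))
                               (λ { refl → ¬ih₀ ih })))
      (λ hs′ v → mk⇔
        (λ v∈J → from (innerHead-true v₀≢t) (new-or-old hs′ v v∈J))
        ([ (λ { refl → v₀∈J }) , (λ ih → p─q⊆p J ⁅ v₀ ⁆ (from (hs′ v) ih)) ]′
           ∘ to (innerHead-true v₀≢t)))
      where
      new-or-old : IsInnerHeadSet hd′ H (J ∖ v₀) → ∀ v → v ∈ J → v₀ ≡ v ⊎ InnerHead hd′ H v
      new-or-old hs′ v v∈J with v₀ ≟ v
      ... | yes v₀≡v = inj₁ v₀≡v
      ... | no v₀≢v = inj₂ (to (hs′ v) (x∈p∧x≢y⇒x∈p-y v∈J (v₀≢v ∘ sym)))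

    ¬headSet-missing-head : v₀ ∉ J → ¬ IsInnerHeadSet hd (true ∷ H) J
    ¬headSet-missing-head v₀∉J hs = v₀∉J (from (hs v₀) (from (innerHead-true v₀≢t) (inj₁ refl)))

    headSet-step : Dec (v₀ ∈ J) → Dec (InnerHead hd′ H v₀) →
        𝟙 (isInnerHeadSet? hd′ H (J ∖ v₀)) * (ε H * ε (J ∖ v₀))
      - 𝟙 (isInnerHeadSet? hd′ H J) * (ε H * ε J)
      ≡ 𝟙 (isInnerHeadSet? hd (true ∷ H) J) * (- ε H * ε J)
    headSet-step (no v₀∉J) _ rewrite x∉p⇒p∖x≡p v₀∉J = begin
      i′ * (ε H * ε J) - i′ * (ε H * ε J)  ≡⟨ +-inverseʳ (i′ * (ε H * ε J)) ⟩
      0ℚ                                   ≡⟨ sym (*-zeroˡ (- ε H * ε J)) ⟩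
      0ℚ * (- ε H * ε J)                   ≡⟨ cong (_* (- ε H * ε J)) (𝟙-no i? (¬headSet-missing-head v₀∉J)) ⟨
      𝟙 i? * (- ε H * ε J)                 ∎
      where
      open ≡-Reasoning
      i? = isInnerHeadSet? hd (true ∷ H) J
      i′ = 𝟙 (isInnerHeadSet? hd′ H J)
    headSet-step (yes _) (yes ih₀) = trans
      (cong₂ (λ a b → a * (ε H * ε (J ∖ v₀)) - b * (ε H * ε J))
             (𝟙-no (isInnerHeadSet? hd′ H (J ∖ v₀)) (λ hs → x∉p∖x v₀ J (from (hs v₀) ih₀)))
             (𝟙-cong (⇔.sym (headSet-old-head ih₀)) (isInnerHeadSet? hd′ H J) i?))
      (solve 4 (λ i x y z → con 0ℚ :* (x :* z) :- i :* (x :* y) := i :* (:- x :* y)) refl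
             (𝟙 i?) (ε H) (ε J) (ε (J ∖ v₀)))
      where
      i? = isInnerHeadSet? hd (true ∷ H) J
    headSet-step (yes v₀∈J) (no ¬ih₀) rewrite ε-∖ v₀∈J = trans
      (cong₂ (λ a b → a * (ε H * ε (J ∖ v₀)) - b * (ε H * - ε (J ∖ v₀)))
             (𝟙-cong (⇔.sym (headSet-new-head ¬ih₀ v₀∈J)) (isInnerHeadSet? hd′ H (J ∖ v₀)) i?)
             (𝟙-no (isInnerHeadSet? hd′ H J) (λ hs → ¬ih₀ (to (hs v₀) v₀∈J))))
      (solve 3 (λ i x z → i :* (x :* z) :- con 0ℚ :* (x :* (:- z)) := i :* (:- x :* (:- z))) refl
             (𝟙 i?) (ε H) (ε (J ∖ v₀)))
      where
      i? = isInnerHeadSet? hd (true ∷ H) J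

  μ-covers-false : ∀ {m} (hd : Fin (suc m) → Fin n) J H →
    μ (𝟙 ∘ covers? hd J ∘ (false ∷_)) H ≡ μ (𝟙 ∘ covers? (hd ∘ suc) J) H
  μ-covers-false hd J = μ-cong λ S → 𝟙-cong covers-false (covers? hd J (false ∷ S)) (covers? (hd ∘ suc) J S)

  μ-covers : ∀ {m} (hd : Fin m → Fin n) J H →
    μ (𝟙 ∘ covers? hd J) H ≡ 𝟙 (isInnerHeadSet? hd H J) * (ε H * ε J)
  μ-covers hd J [] = trans (𝟙-cong covers-[] (covers? hd J []) (isInnerHeadSet? hd [] J))
                           (𝟙-absorb (isInnerHeadSet? hd [] J) (λ hs → trans (*-identityˡ (ε J)) (ε-J hs)))
    where
    ε-J : IsInnerHeadSet hd [] J → ε J ≡ 1ℚ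
    ε-J hs = trans (cong ε (Empty-unique λ (v , v∈J) → case proj₂ (to (hs v) v∈J) of λ { (() , _) }))
                   (ε-∅ n)
  μ-covers hd J (false ∷ H) = begin
    μ (𝟙 ∘ covers? hd J ∘ (false ∷_)) H
      ≡⟨ μ-covers-false hd J H ⟩
    μ (𝟙 ∘ covers? (hd ∘ suc) J) H
      ≡⟨ μ-covers (hd ∘ suc) J H ⟩
    𝟙 (isInnerHeadSet? (hd ∘ suc) H J) * (ε H * ε J)
      ≡⟨ cong (_* (ε H * ε J)) (𝟙-cong (headSet-cong (⇔.sym innerHead-false))
                                       (isInnerHeadSet? (hd ∘ suc) H J) (isInnerHeadSet? hd (false ∷ H) J)) ⟩
    𝟙 (isInnerHeadSet? hd (false ∷ H) J) * (ε H * ε J) ∎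
    where open ≡-Reasoning
  μ-covers hd J (true ∷ H) = by-head (hd zero ≟ t)
    where
    open ≡-Reasoning
    v₀ = hd zero
    hd′ = hd ∘ suc
    i? = isInnerHeadSet? hd (true ∷ H) J
    by-head : Dec (v₀ ≡ t) → μ (𝟙 ∘ covers? hd J) (true ∷ H) ≡ 𝟙 i? * (- ε H * ε J)
    by-head (yes v₀≡t) = begin
      μ (𝟙 ∘ covers? hd J ∘ (true ∷_)) H - μ (𝟙 ∘ covers? hd J ∘ (false ∷_)) H
        ≡⟨ cong₂ _-_ (μ-cong (λ S → 𝟙-no (covers? hd J (true ∷ S)) (covers-true-t v₀≡t)) H)
                     (μ-covers-false hd J H) ⟩
      μ (λ _ → 0ℚ) H - μ (𝟙 ∘ covers? hd′ J) H
        ≡⟨ cong₂ _-_ (μ-0 H) (μ-covers hd′ J H) ⟩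
      0ℚ - 𝟙 (isInnerHeadSet? hd′ H J) * (ε H * ε J)
        ≡⟨ cong (λ x → 0ℚ - x * (ε H * ε J))
                (𝟙-cong (headSet-cong (⇔.sym (innerHead-true-t v₀≡t))) (isInnerHeadSet? hd′ H J) i?) ⟩
      0ℚ - 𝟙 i? * (ε H * ε J)
        ≡⟨ solve 3 (λ i x y → con 0ℚ :- i :* (x :* y) := i :* (:- x :* y)) refl (𝟙 i?) (ε H) (ε J) ⟩
      𝟙 i? * (- ε H * ε J) ∎
    by-head (no v₀≢t) = begin
      μ (𝟙 ∘ covers? hd J ∘ (true ∷_)) H - μ (𝟙 ∘ covers? hd J ∘ (false ∷_)) H
        ≡⟨ cong₂ _-_ (μ-cong (λ S → 𝟙-cong (covers-true v₀≢t) (covers? hd J (true ∷ S))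
                                                               (covers? hd′ (J ∖ v₀) S)) H)
                     (μ-covers-false hd J H) ⟩
      μ (𝟙 ∘ covers? hd′ (J ∖ v₀)) H - μ (𝟙 ∘ covers? hd′ J) H
        ≡⟨ cong₂ _-_ (μ-covers hd′ (J ∖ v₀) H) (μ-covers hd′ J H) ⟩
        𝟙 (isInnerHeadSet? hd′ H (J ∖ v₀)) * (ε H * ε (J ∖ v₀))
      - 𝟙 (isInnerHeadSet? hd′ H J) * (ε H * ε J)
        ≡⟨ headSet-step v₀≢t (v₀ ∈? J) (innerHead? hd′ H v₀) ⟩
      𝟙 i? * (- ε H * ε J) ∎

-- Walks and reachability

module Walks {n m : ℕ} (G : Multigraph n m) where

  arcs : ∀ {u v} → Walk G u v → List (Fin m)
  arcs nil = []
  arcs (cons e _ w) = e ∷ arcs w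

  ∈-arcSet : ∀ {u v e} (w : Walk G u v) → e ∈ arcSet G w ⇔ e ∈ₗ arcs w
  ∈-arcSet nil = mk⇔ (⊥-elim ∘ ∉⊥) λ ()
  ∈-arcSet (cons a _ w) = mk⇔
    ([ Any.here ∘ x∈⁅y⁆⇒x≡y a , Any.there ∘ to (∈-arcSet w) ]′ ∘ x∈p∪q⁻ ⁅ a ⁆ (arcSet G w))
    (λ { (Any.here refl) → x∈p∪q⁺ (inj₁ (x∈⁅x⁆ a))
       ; (Any.there e∈w) → x∈p∪q⁺ (inj₂ (from (∈-arcSet w) e∈w)) })

  Within : ∀ {u v} → Subset m → Walk G u v → Set
  Within X w = All (_∈ X) (arcs w)

  Reach : Subset m → Fin n → Fin n → Set
  Reach X u v = Σ (Walk G u v) (Within X)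

  reach-refl : ∀ {X u} → Reach X u u
  reach-refl = nil , []

  reach-cons : ∀ {X u v a} → a ∈ X → tail G a ≡ u → Reach X (head G a) v → Reach X u v
  reach-cons a∈X eq (w , within) = cons _ eq w , a∈X ∷ within

  reach-mono : ∀ {X Y u v} → X ⊆ Y → Reach X u v → Reach Y u v
  reach-mono X⊆Y (w , within) = w , All.map X⊆Y within

  through : ∀ {X u v e} → Reach X u (tail G e) → e ∈ X → Reach X (head G e) v →
    Σ (Walk G u v) λ w → NonEmpty G w × Within X w × e ∈ₗ arcs w
  through (nil , []) e∈X (w , within) = cons _ refl w , tt , e∈X ∷ within , Any.here refl
  through (cons a eq w₁ , a∈X ∷ within₁) e∈X r₂ with through (w₁ , within₁) e∈X r₂
  ... | w , _ , within , e∈w = cons a eq w , tt , a∈X ∷ within , Any.there e∈w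

  split-at : ∀ {X u v e} (w : Walk G u v) → Within X w → e ∈ₗ arcs w →
    Reach X u (tail G e) × Reach X (head G e) v
  split-at (cons a refl w) (_ ∷ within) (Any.here refl) = reach-refl , (w , within)
  split-at (cons a refl w) (a∈X ∷ within) (Any.there e∈w) with split-at w within e∈w
  ... | r₁ , r₂ = reach-cons a∈X refl r₁ , r₂

  first-arc : ∀ {X u v} → Reach X u v → u ≢ v → ∃ λ a → a ∈ X × tail G a ≡ u
  first-arc (nil , []) u≢v = ⊥-elim (u≢v refl)
  first-arc (cons a eq _ , a∈X ∷ _) _ = a , a∈X , eq

  last-arc : ∀ {X u v} → Reach X u v → u ≢ v → Enters (head G) X v
  last-arc (w , within) = last-arc-of w within
    where
    last-arc-of : ∀ {X u v} (w : Walk G u v) → Within X w → u ≢ v → Enters (head G) X v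
    last-arc-of nil [] u≢v = ⊥-elim (u≢v refl)
    last-arc-of {v = v} (cons a _ w) (a∈X ∷ within) _ with head G a ≟ v
    ... | yes eq = a , a∈X , eq
    ... | no a↛v = last-arc-of w within a↛v

  within-avoiding : ∀ {X Y u v e} → (∀ {a} → a ≢ e → a ∈ X → a ∈ Y) →
    (w : Walk G u v) → e ∉ₗ arcs w → Within X w → Within Y w
  within-avoiding agree nil _ [] = []
  within-avoiding agree (cons a _ w) e∉w (a∈X ∷ within) =
    agree (λ { refl → e∉w (Any.here refl) }) a∈X ∷ within-avoiding agree w (e∉w ∘ Any.there) within

  within-unreaching : ∀ {X Y u v e} → (∀ {a} → a ≢ e → a ∈ Y → a ∈ X) →
    ¬ Reach X u (tail G e) → (w : Walk G u v) → Within Y w → Within X w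
  within-unreaching agree unreached nil [] = []
  within-unreaching {e = e} agree unreached (cons a refl w) (a∈Y ∷ within) with a ≟ e
  ... | yes refl = ⊥-elim (unreached reach-refl)
  ... | no a≢e = a∈X ∷ within-unreaching agree (unreached ∘ reach-cons a∈X refl) w within
    where a∈X = agree a≢e a∈Y

  ReachIn : ℕ → Subset m → Fin n → Fin n → Set
  ReachIn zero X u v = u ≡ v
  ReachIn (suc k) X u v = u ≡ v ⊎ ∃ λ a → (a ∈ X × tail G a ≡ u) × ReachIn k X (head G a) v

  reachIn? : ∀ k X u v → Dec (ReachIn k X u v)
  reachIn? zero X u v = u ≟ v
  reachIn? (suc k) X u v =
    (u ≟ v) ⊎-dec any? (λ a → ((a ∈? X) ×-dec (tail G a ≟ u)) ×-dec reachIn? k X (head G a) v)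

  reachIn⇒reach : ∀ k {X u v} → ReachIn k X u v → Reach X u v
  reachIn⇒reach zero refl = reach-refl
  reachIn⇒reach (suc k) (inj₁ refl) = reach-refl
  reachIn⇒reach (suc k) (inj₂ (a , (a∈X , eq) , r)) = reach-cons a∈X eq (reachIn⇒reach k r)

  reach⇒reachIn : ∀ {k X u v} (w : Walk G u v) → Within X w → length (arcs w) ≤ k → ReachIn k X u v
  reach⇒reachIn {zero} nil [] _ = refl
  reach⇒reachIn {suc k} nil [] _ = inj₁ refl
  reach⇒reachIn {suc k} (cons a eq w) (a∈X ∷ within) (s≤s len≤k) =
    inj₂ (a , (a∈X , eq) , reach⇒reachIn w within len≤k)

  module _ (acyclic : Acyclic G) where

    nonEmpty⇒≢ : ∀ {u v} (w : Walk G u v) → NonEmpty G w → u ≢ v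
    nonEmpty⇒≢ w ne refl = acyclic _ w ne

    vertex : ∀ {u v} (w : Walk G u v) → Fin (suc (length (arcs w))) → Fin n
    vertex {u} w zero = u
    vertex (cons _ _ w) (suc i) = vertex w i

    prefix : ∀ {u v} (w : Walk G u v) i → Walk G u (vertex w i)
    prefix w zero = nil
    prefix (cons e eq w) (suc i) = cons e eq (prefix w i)

    segment : ∀ {u v} (w : Walk G u v) i j → i <ᶠ j → Σ (Walk G (vertex w i) (vertex w j)) (NonEmpty G)
    segment (cons e eq w) zero (suc j) _ = cons e eq (prefix w j) , tt
    segment (cons e eq w) (suc i) (suc j) (s≤s i<j) = segment w i j i<j

    -- By pigeonhole, a walk of length ≥ n repeats a vertex and so contains a cycle.
    length<n : ∀ {u v} (w : Walk G u v) → length (arcs w) < n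
    length<n w = ≰⇒> λ n≤len →
      let (i , j , i<j , same) = pigeonhole (s≤s n≤len) (vertex w)
          (c , ne) = segment w i j i<j
      in nonEmpty⇒≢ c ne same

    reach? : ∀ X u v → Dec (Reach X u v)
    reach? X u v = map′ (reachIn⇒reach n) (λ (w , within) → reach⇒reachIn w within (<⇒≤ (length<n w)))
                        (reachIn? n X u v)

    -- Walking backwards along entering arcs must reach s within n steps, by acyclicity.
    reach-backwards : ∀ {X s} (P : Fin n → Set) →
      (∀ {v} → P v → v ≢ s → ∃ λ a → a ∈ X × head G a ≡ v × P (tail G a)) →
      ∀ {v} → P v → Reach X s v
    reach-backwards {X} {s} P entered pv = climb n nil [] pv (m≤m+n n 0)
      where
      climb : ∀ k {u z} (acc : Walk G u z) → Within X acc → P u →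
              n ≤ k ℕ.+ length (arcs acc) → Reach X s z
      climb zero acc _ _ n≤len = ⊥-elim (<⇒≱ (length<n acc) n≤len)
      climb (suc k) {u} acc within pu n≤ with u ≟ s
      ... | yes refl = acc , within
      ... | no u≢s with entered pu u≢s
      ... | a , a∈X , refl , pa =
        climb k (cons a refl acc) (a∈X ∷ within) pa (subst (n ≤_) (sym (+-suc k _)) n≤)

-- Connectivity

module Connectivity {n m : ℕ} (G : Multigraph n m) (s t : Fin n) (acyclic : Acyclic G) where
  open Walks G

  Conn : Subset m → Set
  Conn X = Σ (Path G s t) λ p → Within X (proj₁ p)

  connected⇔conn : ∀ {x X} → (∀ {e} → x e ≡ true ⇔ e ∈ X) → Connected G s t x ⇔ Conn X
  connected⇔conn agree = mk⇔
    (λ ((w , ne) , present) → (w , ne) , All.tabulate λ e∈w →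
       to agree (present _ (to ∈⇔lookup (from (∈-arcSet w) e∈w))))
    (λ ((w , ne) , within) → (w , ne) , λ e e∈w →
       from agree (All.lookup within (to (∈-arcSet w) (from ∈⇔lookup e∈w))))

  conn⇔reach : ∀ {X} → s ≢ t → Conn X ⇔ Reach X s t
  conn⇔reach s≢t = mk⇔ (λ ((w , _) , within) → w , within) λ where
    (nil , []) → ⊥-elim (s≢t refl)
    (cons a eq w , within) → (cons a eq w , tt) , within

  conn? : ∀ X → Dec (Conn X)
  conn? X = by (s ≟ t)
    where
    by : Dec (s ≡ t) → Dec (Conn X)
    by (yes s≡t) = no λ ((w , ne) , _) → nonEmpty⇒≢ acyclic w ne s≡t
    by (no s≢t) = Dec.map (⇔.sym (conn⇔reach s≢t)) (reach? acyclic X s t)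

  ¬conn-∅ : ¬ Conn ∅
  ¬conn-∅ ((cons a _ _ , _) , a∈∅ ∷ _) = ∉⊥ a∈∅

  connectivity : Subset m → ℚ
  connectivity X = 𝟙 (conn? X)

  ζ≡connectivity⇒represents : ∀ c → (∀ X → ζ c X ≡ connectivity X) → Represents G s t c
  ζ≡connectivity⇒represents c ζc≡ x =
      (λ conn → trans value (𝟙-yes (conn? (tabulate x)) (to connected conn)))
    , (λ ¬conn → trans value (𝟙-no (conn? (tabulate x)) (¬conn ∘ from connected)))
    where
    value = trans (eval-bits c x) (ζc≡ (tabulate x))
    connected = connected⇔conn (⇔.sym ∈-tabulate)

  represents⇒ζ≡connectivity : ∀ c → Represents G s t c → ∀ X → ζ c X ≡ connectivity X
  represents⇒ζ≡connectivity c represents X = begin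
    ζ c X                      ≡⟨ cong (ζ c) (sym (tabulate∘lookup X)) ⟩
    ζ c (tabulate (lookup X))  ≡⟨ sym (eval-bits c (lookup X)) ⟩
    eval c (bitℚ ∘ lookup X)   ≡⟨ by (conn? X) ⟩
    connectivity X             ∎
    where
    open ≡-Reasoning
    connected = connected⇔conn (⇔.sym ∈⇔lookup)
    by : (d : Dec (Conn X)) → eval c (bitℚ ∘ lookup X) ≡ 𝟙 d
    by (yes conn) = proj₁ (represents (lookup X)) (from connected conn)
    by (no ¬conn) = proj₂ (represents (lookup X)) (¬conn ∘ to connected)

  OnPath : Subset m → Fin m → Set
  OnPath H e = Reach H s (tail G e) × Reach H (head G e) t

  onPath? : ∀ H e → Dec (OnPath H e)
  onPath? H e = reach? acyclic H s (tail G e) ×-dec reach? acyclic H (head G e) t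

  allOnPath⇒InU : ∀ {H} → (∀ {e} → e ∈ H → OnPath H e) → InU G s t H
  allOnPath⇒InU {H} onPath = unionOf-cover (arcSet G ∘ proj₁) covered
    where
    covered : ∀ {e} → e ∈ H →
              ∃ λ (p : Path G s t) → e ∈ arcSet G (proj₁ p) × arcSet G (proj₁ p) ⊆ H
    covered e∈H =
      let (w , ne , within , e∈w) = through (proj₁ (onPath e∈H)) e∈H (proj₂ (onPath e∈H))
      in (w , ne) , from (∈-arcSet w) e∈w , All.lookup within ∘ to (∈-arcSet w)

  off-path-arc : ∀ {H} → ¬ InU G s t H → ∃ λ e → e ∈ H × ¬ OnPath H e
  off-path-arc {H} H∉U with all? (λ e → (e ∈? H) →-dec onPath? H e)
  ... | yes all = ⊥-elim (H∉U (allOnPath⇒InU (all _)))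
  ... | no ¬all =
    let (e , bad) = ¬∀⟶∃¬ m _ (λ e → (e ∈? H) →-dec onPath? H e) ¬all
    in e , decidable-stable (e ∈? H) (λ e∉H → bad (⊥-elim ∘ e∉H)) , bad ∘ const

  conn-off-path : ∀ {H X Y e} → ¬ OnPath H e → X ⊆ H → (∀ {a} → a ≢ e → a ∈ X → a ∈ Y) →
    Conn X → Conn Y
  conn-off-path {e = e} off X⊆H agree ((w , ne) , within) = (w , ne) , within-avoiding agree w e∉w within
    where
    e∉w : e ∉ₗ arcs w
    e∉w e∈w = let (r₁ , r₂) = split-at w within e∈w in off (reach-mono X⊆H r₁ , reach-mono X⊆H r₂)

  μ-connectivity-∉U : ∀ {H} → ¬ InU G s t H → μ connectivity H ≡ 0ℚ
  μ-connectivity-∉U {H} H∉U with off-path-arc H∉U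
  ... | e , e∈H , off = μ-toggling (record
    { Toggleable = λ _ a → a ≡ e
    ; toggleable? = λ _ a → a ≟ e
    ; toggleable⇒∈ = λ { refl → e∈H }
    ; toggleable-stable = λ _ _ _ → ⇔.refl
    ; h-stable = λ { {S} S⊆H refl → 𝟙-cong (conn-toggle S⊆H) (conn? (toggle S e)) (conn? S) }
    ; h-vanishes = λ _ none → ⊥-elim (none (e , refl))
    })
    where
    conn-toggle : ∀ {S} → S ⊆ H → Conn (toggle S e) ⇔ Conn S
    conn-toggle {S} S⊆H = mk⇔ (conn-off-path off (toggle-⊆ S⊆H e∈H) (∈-toggle⁻ S))
                              (conn-off-path off S⊆H (∈-toggle⁺ S))

  module UnionOfPaths {H : Subset m} (H∈U : InU G s t H) where
    open HeadSets t

    on-path : ∀ {a} → a ∈ H → Σ (Walk G s t) λ w → NonEmpty G w × Within H w × a ∈ₗ arcs w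
    on-path {a} a∈H =
      let (B , ⋃B≡H) = H∈U
          ((w , ne) , a∈w , w⊆⋃B) = ∈-unionOf⁻ (arcSet G ∘ proj₁) B (subst (a ∈_) (sym ⋃B≡H) a∈H)
      in w , ne , All.tabulate (λ e∈w → subst (_ ∈_) ⋃B≡H (w⊆⋃B (from (∈-arcSet w) e∈w)))
                , to (∈-arcSet w) a∈w

    reach-tail : ∀ {a} → a ∈ H → Reach H s (tail G a)
    reach-tail a∈H = let (w , _ , within , a∈w) = on-path a∈H in proj₁ (split-at w within a∈w)

    reach-head : ∀ {a} → a ∈ H → Reach H (head G a) t
    reach-head a∈H = let (w , _ , within , a∈w) = on-path a∈H in proj₂ (split-at w within a∈w)

    tail≢t : ∀ {a} → a ∈ H → tail G a ≢ t
    tail≢t {a} a∈H = nonEmpty⇒≢ acyclic (cons a refl (proj₁ (reach-head a∈H))) tt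

    head≢s : ∀ {a} → a ∈ H → head G a ≢ s
    head≢s a∈H =
      let (w , ne , _) = through (reach-tail a∈H) a∈H reach-refl in nonEmpty⇒≢ acyclic w ne ∘ sym

    ends-distinct : ∀ {a} → a ∈ H → s ≢ t
    ends-distinct a∈H = let (w , ne , _) = on-path a∈H in nonEmpty⇒≢ acyclic w ne

    I : Subset n
    I = innerVertices G s t H

    ∈-inner : ∀ {v} → v ∈ I ⇔ (v ≢ s × v ≢ t × ∃ λ a → a ∈ H × (tail G a ≡ v ⊎ head G a ≡ v))
    ∈-inner {v} =
      ⇔.trans ∈⇔lookup (⇔.trans (mk⇔ (trans (sym (lookup∘tabulate _ v))) (trans (lookup∘tabulate _ v)))
                                (⇔.trans (⇔.sym T-≡) (by (v ≟ s) (v ≟ t))))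
      where
      T-does : ∀ {P : Set} (P? : Dec P) → T (does P?) ⇔ P
      T-does (yes p) = mk⇔ (const p) (const tt)
      T-does (no ¬p) = mk⇔ (λ ()) ¬p
      touches : Fin m → Bool
      touches a = lookup H a ∧ (does (tail G a ≟ v) ∨ does (head G a ≟ v))
      T-touches : ∀ {a} → T (touches a) ⇔ (a ∈ H × (tail G a ≡ v ⊎ head G a ≡ v))
      T-touches {a} = ⇔.trans T-∧ (⇔.trans T-≡ (⇔.sym ∈⇔lookup) ×-⇔
                                   ⇔.trans T-∨ (T-does (tail G a ≟ v) ⊎-⇔ T-does (head G a ≟ v)))
      any-touches : T (any touches (allFin m)) ⇔ ∃ λ a → a ∈ H × (tail G a ≡ v ⊎ head G a ≡ v)
      any-touches = ⇔.trans (⇔.sym any⇔) (mk⇔ (λ any → let (a , ta) = tabulate⁻ any in a , to T-touches ta)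
                                              (λ (a , ta) → tabulate⁺ a (from T-touches ta)))
      by : (v≟s : Dec (v ≡ s)) (v≟t : Dec (v ≡ t)) →
        T (if does v≟s ∨ does v≟t then false else any touches (allFin m)) ⇔
        (v ≢ s × v ≢ t × ∃ λ a → a ∈ H × (tail G a ≡ v ⊎ head G a ≡ v))
      by (yes v≡s) _ = mk⇔ (λ ()) (λ (v≢s , _) → v≢s v≡s)
      by (no _) (yes v≡t) = mk⇔ (λ ()) (λ (_ , v≢t , _) → v≢t v≡t)
      by (no v≢s) (no v≢t) = mk⇔ (λ x → v≢s , v≢t , to any-touches x) (from any-touches ∘ proj₂ ∘ proj₂)

    inner-tail : ∀ {v} → v ∈ I → ∃ λ a → a ∈ H × tail G a ≡ v
    inner-tail v∈I with to ∈-inner v∈I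
    ... | _ , _ , a , a∈H , inj₁ tail≡v = a , a∈H , tail≡v
    ... | _ , v≢t , a , a∈H , inj₂ refl = first-arc (reach-head a∈H) v≢t

    inner-head : ∀ {v} → v ∈ I → Enters (head G) H v
    inner-head v∈I with to ∈-inner v∈I
    ... | _ , _ , a , a∈H , inj₂ head≡v = a , a∈H , head≡v
    ... | v≢s , _ , a , a∈H , inj₁ refl = last-arc (reach-tail a∈H) (v≢s ∘ sym)

    tail-inner : ∀ {a} → a ∈ H → tail G a ≡ s ⊎ tail G a ∈ I
    tail-inner {a} a∈H with tail G a ≟ s
    ... | yes tail≡s = inj₁ tail≡s
    ... | no tail≢s = inj₂ (from ∈-inner (tail≢s , tail≢t a∈H , a , a∈H , inj₁ refl))

    isInnerHeadSet : IsInnerHeadSet (head G) H I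
    isInnerHeadSet v = mk⇔ (λ v∈I → proj₁ (proj₂ (to ∈-inner v∈I)) , inner-head v∈I)
      λ { (v≢t , a , a∈H , refl) → from ∈-inner (head≢s a∈H , v≢t , a , a∈H , inj₂ refl) }

    Unreached : Subset m → Fin m → Set
    Unreached S e = e ∈ H × ¬ Reach S s (tail G e)

    unreached? : ∀ S e → Dec (Unreached S e)
    unreached? S e = (e ∈? H) ×-dec ¬? (reach? acyclic S s (tail G e))

    reach-toggle : ∀ {S e} → ¬ Reach S s (tail G e) → ∀ {v} → Reach (toggle S e) s v ⇔ Reach S s v
    reach-toggle {S} unreached = mk⇔
      (λ (w , within) → w , within-unreaching (∈-toggle⁻ S) unreached w within)
      (λ (w , within) → w , within-avoiding (∈-toggle⁺ S) w (unreached ∘ proj₁ ∘ split-at w within) within)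

    some-unreached? : ∀ S → Dec (∃ (Unreached S))
    some-unreached? S = any? (unreached? S)

    some-unreached-toggle : ∀ {S e} → ¬ Reach S s (tail G e) → ∃ (Unreached (toggle S e)) ⇔ ∃ (Unreached S)
    some-unreached-toggle unreached = mk⇔
      (λ (e′ , e′∈H , ¬r) → e′ , e′∈H , ¬r ∘ from (reach-toggle unreached))
      (λ (e′ , e′∈H , ¬r) → e′ , e′∈H , ¬r ∘ to (reach-toggle unreached))

    -- Once the tails of all arcs of H are reached, t is reached iff some arc of S enters it.
    reached⇒covers : ∀ {S} → S ⊆ H → ¬ ∃ (Unreached S) → ¬ Reach S s t → Covers (head G) I S
    reached⇒covers {S} S⊆H none-unreached ¬s⇝t = ¬enters-t , enters-inner
      where
      tail-reached : ∀ {a} → a ∈ H → Reach S s (tail G a)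
      tail-reached {a} a∈H =
        decidable-stable (reach? acyclic S s (tail G a)) (λ ¬r → none-unreached (a , a∈H , ¬r))
      ¬enters-t : ¬ Enters (head G) S t
      ¬enters-t (a , a∈S , head≡t) =
        let (w , _ , within , _) = through (tail-reached (S⊆H a∈S)) a∈S reach-refl
        in ¬s⇝t (subst (Reach S s) head≡t (w , within))
      enters-inner : ∀ v → v ∈ I → Enters (head G) S v
      enters-inner v v∈I =
        let (b , b∈H , tail≡v) = inner-tail v∈I
        in last-arc (subst (Reach S s) tail≡v (tail-reached b∈H)) (proj₁ (to ∈-inner v∈I) ∘ sym)

    covers⇒reached : ∀ {S} → s ≢ t → S ⊆ H → Covers (head G) I S →
                     ¬ ∃ (Unreached S) × ¬ Reach S s t
    covers⇒reached {S} s≢t S⊆H (¬enters-t , enters-inner) =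
        (λ (e , e∈H , ¬r) →
           ¬r (reach-backwards acyclic (λ v → v ≡ s ⊎ v ∈ I) entered (tail-inner e∈H)))
      , (λ s⇝t → ¬enters-t (last-arc s⇝t s≢t))
      where
      entered : ∀ {v} → v ≡ s ⊎ v ∈ I → v ≢ s →
                ∃ λ a → a ∈ S × head G a ≡ v × (tail G a ≡ s ⊎ tail G a ∈ I)
      entered (inj₁ v≡s) v≢s = ⊥-elim (v≢s v≡s)
      entered (inj₂ v∈I) _ =
        let (a , a∈S , head≡v) = enters-inner _ v∈I in a , a∈S , head≡v , tail-inner (S⊆H a∈S)

    disconnected : Subset m → ℚ
    disconnected S = 𝟙 (¬? (reach? acyclic S s t))

    unreached-toggling : TogglingInvolution H (λ S → 𝟙 (some-unreached? S) * disconnected S)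
    unreached-toggling = record
      { Toggleable = Unreached
      ; toggleable? = unreached?
      ; toggleable⇒∈ = proj₁
      ; toggleable-stable = λ _ (_ , unreached) e′ → ⇔.refl ×-⇔ ¬-cong-⇔ (reach-toggle unreached)
      ; h-stable = λ {S} {e} _ (_ , unreached) → cong₂ _*_
          (𝟙-cong (some-unreached-toggle unreached) (some-unreached? (toggle S e)) (some-unreached? S))
          (𝟙-cong (¬-cong-⇔ (reach-toggle unreached))
                  (¬? (reach? acyclic (toggle S e) s t)) (¬? (reach? acyclic S s t)))
      ; h-vanishes = λ {S} _ none →
          trans (cong (_* disconnected S) (𝟙-no (some-unreached? S) none)) (*-zeroˡ (disconnected S))
      }

    μ-disconnected : s ≢ t → μ disconnected H ≡ ε H * ε I
    μ-disconnected s≢t = begin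
      μ disconnected H
        ≡⟨ μ-cong (λ S → 𝟙-split (some-unreached? S) (disconnected S)) H ⟩
      μ (λ S → 𝟙 (some-unreached? S) * disconnected S + 𝟙 (¬? (some-unreached? S)) * disconnected S) H
        ≡⟨ μ-+ _ _ H ⟩
        μ (λ S → 𝟙 (some-unreached? S) * disconnected S) H
      + μ (λ S → 𝟙 (¬? (some-unreached? S)) * disconnected S) H
        ≡⟨ cong₂ _+_ (μ-toggling unreached-toggling) (μ-cong-⊆ H survivors) ⟩
      0ℚ + μ (𝟙 ∘ covers? (head G) I) H
        ≡⟨ +-identityˡ _ ⟩
      μ (𝟙 ∘ covers? (head G) I) H
        ≡⟨ μ-covers (head G) I H ⟩
      𝟙 (isInnerHeadSet? (head G) H I) * (ε H * ε I)
        ≡⟨ cong (_* (ε H * ε I)) (𝟙-yes (isInnerHeadSet? (head G) H I) isInnerHeadSet) ⟩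
      1ℚ * (ε H * ε I)
        ≡⟨ *-identityˡ (ε H * ε I) ⟩
      ε H * ε I ∎
      where
      open ≡-Reasoning
      survivors : ∀ {S} → S ⊆ H →
                  𝟙 (¬? (some-unreached? S)) * disconnected S ≡ 𝟙 (covers? (head G) I S)
      survivors {S} S⊆H = trans (𝟙-× (¬? (some-unreached? S)) (¬? (reach? acyclic S s t)))
        (𝟙-cong (mk⇔ (λ (none , ¬s⇝t) → reached⇒covers S⊆H none ¬s⇝t) (covers⇒reached s≢t S⊆H))
                (¬? (some-unreached? S) ×-dec ¬? (reach? acyclic S s t)) (covers? (head G) I S))

    μ-connectivity-∈U : Nonempty H → μ connectivity H ≡ - (ε H * ε I)
    μ-connectivity-∈U (a , a∈H) = begin
      μ connectivity H
        ≡⟨ μ-cong connectivity≡1-disconnected H ⟩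
      μ (λ S → 1ℚ - disconnected S) H
        ≡⟨ μ-─ (λ _ → 1ℚ) disconnected H ⟩
      μ (λ _ → 1ℚ) H - μ disconnected H
        ≡⟨ cong₂ _-_ (μ-const 1ℚ H (a , a∈H)) (μ-disconnected (ends-distinct a∈H)) ⟩
      0ℚ - ε H * ε I
        ≡⟨ +-identityˡ (- (ε H * ε I)) ⟩
      - (ε H * ε I) ∎
      where
      open ≡-Reasoning
      connectivity≡1-disconnected : ∀ S → connectivity S ≡ 1ℚ - disconnected S
      connectivity≡1-disconnected S =
        trans (𝟙-cong (conn⇔reach (ends-distinct a∈H)) (conn? S) (reach? acyclic S s t))
              (𝟙-¬ (reach? acyclic S s t))

neg1^-⊖ : ∀ a b → neg1^ ∣ a ⊖ b ∣ ≡ neg1^ a * neg1^ b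
neg1^-⊖ zero zero = sym (*-identityˡ 1ℚ)
neg1^-⊖ (suc a) zero = sym (*-identityʳ (neg1^ (suc a)))
neg1^-⊖ zero (suc b) = sym (*-identityˡ (neg1^ (suc b)))
neg1^-⊖ (suc a) (suc b) = begin
  neg1^ ∣ suc a ⊖ suc b ∣  ≡⟨ cong (λ z → neg1^ ∣ z ∣) ([1+m]⊖[1+n]≡m⊖n a b) ⟩
  neg1^ ∣ a ⊖ b ∣          ≡⟨ neg1^-⊖ a b ⟩
  neg1^ a * neg1^ b        ≡⟨ solve 2 (λ x y → x :* y := (:- x) :* (:- y)) refl (neg1^ a) (neg1^ b) ⟩
  - neg1^ a * - neg1^ b    ∎
  where open ≡-Reasoning

[+a-+b]-1≡+a-+[1+b] : ∀ a b → (ℤ.+ a ℤ.- ℤ.+ b) ℤ.- ℤ.+ 1 ≡ ℤ.+ a ℤ.- ℤ.+ suc b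
[+a-+b]-1≡+a-+[1+b] a b = begin
  (ℤ.+ a ℤ.- ℤ.+ b) ℤ.- ℤ.+ 1      ≡⟨ ℤ.+-assoc (ℤ.+ a) (ℤ.- ℤ.+ b) (ℤ.- ℤ.+ 1) ⟩
  ℤ.+ a ℤ.+ (ℤ.- ℤ.+ b ℤ.- ℤ.+ 1)  ≡⟨ cong (λ z → ℤ.+ a ℤ.+ z) (ℤ.neg-distrib-+ (ℤ.+ b) (ℤ.+ 1)) ⟨
  ℤ.+ a ℤ.- (ℤ.+ b ℤ.+ ℤ.+ 1)      ≡⟨ cong (λ z → ℤ.+ a ℤ.- z) (ℤ.+-comm (ℤ.+ b) (ℤ.+ 1)) ⟩
  ℤ.+ a ℤ.- ℤ.+ suc b              ∎
  where open ≡-Reasoning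

sign-D : ∀ a b → sign ((ℤ.+ a ℤ.- ℤ.+ b) ℤ.- ℤ.+ 1) ≡ - (neg1^ a * neg1^ b)
sign-D a b = begin
  neg1^ ∣ (ℤ.+ a ℤ.- ℤ.+ b) ℤ.- ℤ.+ 1 ∣  ≡⟨ cong (λ z → neg1^ ∣ z ∣)
                                              (trans ([+a-+b]-1≡+a-+[1+b] a b) ([+m]-[+n]≡m⊖n a (suc b))) ⟩
  neg1^ ∣ a ⊖ suc b ∣                    ≡⟨ neg1^-⊖ a (suc b) ⟩
  neg1^ a * - neg1^ b
    ≡⟨ solve 2 (λ x y → x :* (:- y) := :- (x :* y)) refl (neg1^ a) (neg1^ b) ⟩
  - (neg1^ a * neg1^ b)                  ∎
  where open ≡-Reasoning

mainTheorem4 : ∀ {n m : ℕ} (G : Multigraph n m) (s t : Fin n) →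
    Acyclic G → UniqueSource G s → UniqueSink G t →
    Σ (MultilinearPoly m) λ p →
      IsPG G s t p × Represents G s t p ×
      (∀ (q : MultilinearPoly m) → Represents G s t q → ∀ (H : Subset m) → q H ≡ p H)
mainTheorem4 G s t acyclic _ _ = μ connectivity , isPG , represents , unique
  where
  open Connectivity G s t acyclic
  isPG : IsPG G s t (μ connectivity)
  isPG H = (λ H∈U H≢∅ → trans (UnionOfPaths.μ-connectivity-∈U H∈U (nonempty H≢∅))
                              (sym (sign-D (card H) (card (innerVertices G s t H)))))
         , λ { (inj₁ H∉U) → μ-connectivity-∉U H∉U
             ; (inj₂ refl) → trans (μ-∅ connectivity) (𝟙-no (conn? ∅) ¬conn-∅) }
    where
    nonempty : H ≢ ∅ → Nonempty H
    nonempty H≢∅ = decidable-stable (nonempty? H) (H≢∅ ∘ Empty-unique)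
  represents : Represents G s t (μ connectivity)
  represents = ζ≡connectivity⇒represents (μ connectivity) (ζ∘μ connectivity)
  unique : ∀ q → Represents G s t q → ∀ H → q H ≡ μ connectivity H
  unique q q-represents H = trans (sym (μ∘ζ q H)) (μ-cong (represents⇒ζ≡connectivity q q-represents) H)
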